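{- Let $m,n,s,k$ be positive integers with $m+s=n+k$, and let $\mathbf a=(a_1,\ldots,a_s)$, $\mathbf d=(d_1,\ldots,d_m)$, $\mathbf b=(b_1,\ldots,b_k)$, $\mathbf c=(c_1,\ldots,c_n)$ be partitions with $c_i\ne d_j$ for all $i,j$. With the notation of the context: if $c^{h'}\ge a_s$ then $t_y<s$ for all $y=0,\ldots,h'-1$; and if $d^h\ge b_k$ then $t'_x<k$ for all $x=0,\ldots,h-1$.
   Context: A partition is a finite nonincreasing sequence of integers. Empty sums are $0$; for any sequence $y_1,\ldots,y_w$ one sets $y_i=+\infty$ for $i\le0$ and $y_i=-\infty$ for $i>w$. $\mathbf e$ is the nonincreasing rearrangement of all entries of $\mathbf d$ and $\mathbf a$, where whenever some $d_i$ equals some $a_j$, the $a$'s of that value are placed before the $d$'s of that value; $\mathbf e'$ is defined the same way from $\mathbf c$ and $\mathbf b$ (equal $b$'s before equal $c$'s). Sets $S\subseteq\{1,\ldots,n\}$, $\Delta\subseteq\{1,\ldots,m\}$ are defined inductively: start with $S=\Delta=\emptyset$ and process all entries of $\mathbf c$ and $\mathbf d$ one at a time, from the smallest value to the largest; among equal entries of $\mathbf c$ (resp. $\mathbf d$) the one with the larger index is processed first. All sets and counts below refer to the decisions made so far. If the processed entry is $d_j$: set $q_j=s-\#\{i\in S\mid c_i<d_j\}+\#\{i>j\mid i\notin\Delta\}+1$. If $q_j>s$, put $j\in\Delta$. If $q_j\le s$, let $l\in S$ be the minimal index with $d_j>c_l$, and let $N=\#\{i\mid a_i>c_l\}-s+\#\{i\in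 S\mid i>l\}-\#\{i\notin\Delta\mid d_i<c_l\}+1$. (a) If $N\ge1$ and the entry $d_j$ of $\mathbf e$ is among the $N$ smallest entries of $\mathbf e$ that are larger than $c_l$, put $j\notin\Delta$. (b) Otherwise put $j\notin\Delta$ if $\sum_{i\in S,\,c_i<d_j}c_i\ge\sum_{i\notin\Delta,\,i>j}d_i+d_j+\sum_{i=q_j+1}^{s}a_i$, and $j\in\Delta$ if not. If the processed entry is $c_j$: dually, set $q'_j=k-\#\{i\in\Delta\mid d_i<c_j\}+\#\{i>j\mid i\notin S\}+1$. If $q'_j>k$, put $j\in S$. If $q'_j\le k$, let $l\in\Delta$ be the minimal index with $c_j>d_l$, and $N'=\#\{i\mid b_i>d_l\}-k+\#\{i\in\Delta\mid i>l\}-\#\{i\notin S\mid c_i<d_l\}+1$. (a) If $N'\ge1$ and the entry $c_j$ of $\mathbf e'$ is among the $N'$ smallest entries of $\mathbf e'$ larger than $d_l$, put $j\notin S$. (b) Otherwise put $j\notin S$ if $\sum_{i\in\Delta,\,d_i<c_j}d_i\ge\sum_{i\notin S,\,i>j}c_i+c_j+\sum_{i=q'_j+1}^{k}b_i$, and $j\in S$ if not. Let $h=|\Delta|$, $h'=|S|$; $d^1\ge\cdots\ge d^h$ are the $d_i$ with $i\in\Delta$ and $c^1\ge\cdots\ge c^{h'}$ the $c_i$ with $i\in S$; by convention $c^0=d^0=+\infty$. For $j=1,\ldots,h'$: $t_j=s-(h'-j)+\#\{i\notin\Delta\mid d_i<c^j\}$; for $j=1,\ldots,h$: $t'_j=k-(h-j)+\#\{i\notin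 S\mid c_i<d^j\}$. Also $t_0=m+s-h-h'$ and $t'_0=n+k-h-h'$. -}

module Defs where

open import Data.Bool using (Bool; true; false; if_then_else_; _∧_; not)
open import Data.Nat as ℕ using (ℕ; zero; suc; _∸_)
open import Data.Integer as ℤ using (ℤ; +_; _+_; _-_; _≤ᵇ_; 0ℤ; 1ℤ; ∣_∣)
open import Data.Fin as Fin using (Fin; toℕ)
open import Data.Sum using (_⊎_; inj₁; inj₂; [_,_])
open import Data.Maybe using (Maybe; just; nothing)
open import Data.Product using (_×_; _,_; proj₁; proj₂)
open import Data.List using (List; []; _∷_; length; filterᵇ; findᵇ; allFin;
  reverse; drop; foldl; lookup; map; sum)
open import Relation.Nullary.Decidable using (⌊_⌋)
open import Data.Bool.ListAction using (any)
open import Relation.Binary.PropositionalEquality using (_≡_)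

infix 4 _<ᶻ_
_<ᶻ_ : ℤ → ℤ → Bool
x <ᶻ y = not (y ≤ᵇ x)

-- a partition: a finite nonincreasing sequence of integers (indices 1..n
-- are represented by Fin n, index i ↦ toℕ i + 1)
IsPartition : ∀ {n} → (Fin n → ℤ) → Set
IsPartition {n} f = ∀ (i j : Fin n) → toℕ i ℕ.≤ toℕ j → f j ℤ.≤ f i

cnt : ∀ {n} → (Fin n → Bool) → ℕ
cnt {n} P = length (filterᵇ P (allFin n))

sumWhere : ∀ {n} → (Fin n → Bool) → (Fin n → ℤ) → ℤ
sumWhere {n} P f = foldl (λ acc i → acc + f i) 0ℤ (filterᵇ P (allFin n))

merge : ∀ {A B : Set} → (A → B → Bool) → List A → List B → List (A ⊎ B)
merge t [] ys = Data.List.map inj₂ ys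
merge t xs@(_ ∷ _) [] = Data.List.map inj₁ xs
merge t xs@(x ∷ xs') ys@(y ∷ ys') =
  if t x y then inj₁ x ∷ merge t xs' ys else inj₂ y ∷ merge t xs ys'

-- decisions made so far: nothing = not yet processed,
-- just true = put into the set, just false = put outside the set
Decisions : ℕ → Set
Decisions n = Fin n → Maybe Bool

isIn : Maybe Bool → Bool
isIn (just true) = true
isIn _ = false

isOut : Maybe Bool → Bool
isOut (just false) = true
isOut _ = false

upd : ∀ {n} → Decisions n → Fin n → Bool → Decisions n
upd f i v i' = if ⌊ i' Fin.≟ i ⌋ then just v else f i'

isEntry : ∀ {σ p} → Fin p → Fin σ ⊎ Fin p → Bool
isEntry j (inj₁ _) = false
isEntry j (inj₂ j') = ⌊ j Fin.≟ j' ⌋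

-- One decision step, written once for the processed sequence x (with
-- own set X, companion sequence α) and the other sequence y (with set Y).
-- For an entry d_j:  x = d, X = Δ, y = c, Y = S, α = a, σ = s.
-- For an entry c_j:  x = c, X = S, y = d, Y = Δ, α = b, σ = k.
-- Result: true = put j into X, false = put j outside X.

module Step {σ p r : ℕ} (α : Fin σ → ℤ) (x : Fin p → ℤ) (y : Fin r → ℤ)
            (X : Decisions p) (Y : Decisions r) where

  inY : Fin r → Bool
  inY i = isIn (Y i)

  outX : Fin p → Bool
  outX i = isOut (X i)

  -- e : nonincreasing rearrangement of x and α, α's first among equal values
  eList : List (Fin σ ⊎ Fin p)
  eList = merge (λ i j → x j ≤ᵇ α i) (allFin σ) (allFin p)

  eVal : Fin σ ⊎ Fin p → ℤ
  eVal = [ α , x ]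

  module _ (j : Fin p) where
    q : ℤ
    q = + σ - + cnt (λ i → inY i ∧ (y i <ᶻ x j))
            + + cnt (λ i → (toℕ j ℕ.<ᵇ toℕ i) ∧ outX i) + 1ℤ

    -- case (b): put j outside X iff
    --   Σ_{i∈Y, y_i<x_j} y_i ≥ Σ_{i∉X, i>j} x_i + x_j + Σ_{i=q+1}^{σ} α_i
    -- (with α_i = +∞ for i ≤ 0, so the inequality fails when q+1 ≤ 0)
    lhsB : ℤ
    lhsB = sumWhere (λ i → inY i ∧ (y i <ᶻ x j)) y

    rhsB : ℤ
    rhsB = sumWhere (λ i → (toℕ j ℕ.<ᵇ toℕ i) ∧ outX i) x + x j
           + sumWhere (λ i → q ≤ᵇ + toℕ i) α

    caseB : Bool
    caseB = not ((0ℤ ≤ᵇ q) ∧ (rhsB ≤ᵇ lhsB))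

    module _ (l : Fin r) where
      N : ℤ
      N = + cnt (λ i → y l <ᶻ α i) - + σ
          + + cnt (λ i → inY i ∧ (toℕ l ℕ.<ᵇ toℕ i))
          - + cnt (λ i → outX i ∧ (x i <ᶻ y l)) + 1ℤ

      larger : List (Fin σ ⊎ Fin p)
      larger = filterᵇ (λ e → y l <ᶻ eVal e) eList

      -- (a): N ≥ 1 and x_j is among the N smallest entries of e larger than y_l
      caseA : Bool
      caseA = (1ℤ ≤ᵇ N) ∧ any (isEntry j) (drop (length larger ∸ ∣ N ∣) larger)

      withL : Bool
      withL = if caseA then false else caseB

    -- minimal index l ∈ Y with x_j > y_l (it exists whenever q ≤ σ)
    lMin : Maybe (Fin r)
    lMin = findᵇ (λ i → inY i ∧ (y i <ᶻ x j)) (allFin r)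

    caseLe : Maybe (Fin r) → Bool
    caseLe (just l) = withL l
    caseLe nothing = caseB      -- cannot occur when q ≤ σ

    putIn : Bool
    putIn = if (+ σ) <ᶻ q then true else caseLe lMin

module Construction {s m k n : ℕ} (a : Fin s → ℤ) (d : Fin m → ℤ)
                    (b : Fin k → ℤ) (c : Fin n → ℤ) where

  -- processing order: from smallest value to largest; among equal entries
  -- of c (resp. d) the larger index first (c and d share no value)
  order : List (Fin n ⊎ Fin m)
  order = merge (λ i j → c i <ᶻ d j) (reverse (allFin n)) (reverse (allFin m))

  State : Set
  State = Decisions n × Decisions m

  step : State → Fin n ⊎ Fin m → State
  step (S , Δ) (inj₁ i) = upd S i (Step.putIn b c d S Δ i) , Δ
  step (S , Δ) (inj₂ j) = S , upd Δ j (Step.putIn a d c Δ S j)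

  final : State
  final = foldl step ((λ _ → nothing) , (λ _ → nothing)) order

  inS : Fin n → Bool
  inS i = isIn (proj₁ final i)

  inΔ : Fin m → Bool
  inΔ i = isIn (proj₂ final i)

  notS : Fin n → Bool
  notS i = not (inS i)

  notΔ : Fin m → Bool
  notΔ i = not (inΔ i)

  Slist : List (Fin n)
  Slist = filterᵇ inS (allFin n)

  Δlist : List (Fin m)
  Δlist = filterᵇ inΔ (allFin m)

  h' : ℕ
  h' = length Slist

  h : ℕ
  h = length Δlist

  -- c^{j+1} = (j+1)-st largest c_i with i ∈ S (c is nonincreasing)
  cUp : Fin h' → ℤ
  cUp j = c (lookup Slist j)

  dUp : Fin h → ℤ
  dUp j = d (lookup Δlist j)

  t : Fin (suc h') → ℤ
  t Fin.zero = + (m ℕ.+ s) - + h - + h'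
  t (Fin.suc j) = + s - (+ h' - + suc (toℕ j)) + + cnt (λ i → notΔ i ∧ (d i <ᶻ cUp j))

  t' : Fin (suc h) → ℤ
  t' Fin.zero = + (n ℕ.+ k) - + h - + h'
  t' (Fin.suc j) = + k - (+ h - + suc (toℕ j)) + + cnt (λ i → notS i ∧ (c i <ᶻ dUp j))

  -- "c^{h'} ≥ x", with the convention c^0 = +∞
  cLastGe : ℤ → Set
  cLastGe x = ∀ (j : Fin h') → suc (toℕ j) ≡ h' → x ℤ.≤ cUp j

  -- "d^{h} ≥ x", with the convention d^0 = +∞
  dLastGe : ℤ → Set
  dLastGe x = ∀ (j : Fin h) → suc (toℕ j) ≡ h → x ℤ.≤ dUp j

-- Consider the entries of d (those of c are symmetric) and put A_j = #{i ∈ S | c_i < d_j},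
-- B_j = #{i > j | i ∉ Δ}, so that q_j = s - A_j + B_j + 1.  Replaying the sweep shows that
-- every decision is the one taken on the snapshot of its own turn, so j ∉ Δ forces q_j ≤ s,
-- i.e. B_j < A_j.  When c^{h'} ≥ a_s the tight case A_j = B_j + 1 cannot occur either: then
-- q_j = s, the a-sum in (b) is empty and the c_i summed on the left are strictly dominated,
-- one by one, by d_j and the d_i summed on the right, so (b) puts j into Δ; and in (a) one has
-- N ≤ #{i > j | i ∉ Δ, d_i > c_l}, while d_j and these d_i are entries of e above c_l that come
-- no earlier than d_j, so d_j is not among the N smallest of them.  Hence B_j + 2 ≤ A_j
-- whenever j ∉ Δ.  For the first such j below a threshold θ this bounds the number of i ∉ Δ
-- with d_i < θ by A_j - 1; taking θ = +∞ and θ = c^{y+1} gives m - h < h' and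
-- #{i ∉ Δ | d_i < c^{y+1}} < h' - y - 1, which are t_0 < s and t_{y+1} < s.

module Submission where

open import Defs
open import Data.Nat as ℕ using (ℕ; zero; suc; _+_; _∸_; _≤_; _<_; z≤n; s≤s)
open import Data.Integer as ℤ using (ℤ; +_)
open import Data.Fin as Fin using (Fin; toℕ)
open import Data.Product using (_×_; _,_; proj₁; proj₂; Σ)
open import Data.Sum using (_⊎_; inj₁; inj₂)
open import Data.Bool using (Bool; true; false; if_then_else_; _∧_; not; T)
open import Data.Bool.ListAction using (any)
open import Data.Maybe using (Maybe; just; nothing)
open import Data.List using (List; []; _∷_; [_]; _++_; length; filterᵇ; findᵇ; allFin;
  map; foldl; foldr; drop; take; reverse; lookup)
open import Data.List.Relation.Unary.All as All using (All; []; _∷_)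
open import Data.List.Relation.Unary.Any using (here; there)
open import Data.List.Relation.Unary.AllPairs as AllPairs using (AllPairs; []; _∷_)
import Data.List.Relation.Unary.AllPairs.Properties as AllPairsₚ
open import Data.List.Membership.Propositional using (_∈_)
open import Data.Empty using (⊥; ⊥-elim)
open import Data.Unit using (⊤; tt)
open import Function using (_∘_; id; Equivalence)
open import Relation.Nullary using (yes; no; Dec)
open import Relation.Nullary.Decidable using (T?)
open import Relation.Binary.PropositionalEquality
  using (_≡_; _≢_; _≗_; refl; sym; trans; cong; cong₂; subst; subst₂; module ≡-Reasoning)
import Data.Bool.Properties as BP
import Data.Nat.Properties as NP
import Data.Integer.Properties as ZP
import Data.Fin.Properties as FP
import Data.List.Properties as LP
import Data.List.Membership.Propositional.Properties as MP
open import Algebra.Properties.CommutativeSemigroup NP.+-commutativeSemigroup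
  using () renaming (interchange to +-interchange)
import Data.Integer.Solver
import Data.Nat.Solver

T⇒≡true : ∀ {b} → T b → b ≡ true
T⇒≡true = Equivalence.to BP.T-≡

≡true⇒T : ∀ {b} → b ≡ true → T b
≡true⇒T = Equivalence.from BP.T-≡

∧-elim : ∀ {a b : Bool} → (a ∧ b) ≡ true → a ≡ true × b ≡ true
∧-elim {true} {true} _ = refl , refl

∧-intro : ∀ {a b : Bool} → a ≡ true → b ≡ true → (a ∧ b) ≡ true
∧-intro refl refl = refl

<ᶻ⇒< : ∀ {x y : ℤ} → (x <ᶻ y) ≡ true → x ℤ.< y
<ᶻ⇒< {x} {y} e with y ℤ.≤ᵇ x in eq
... | false = ZP.≰⇒> (λ y≤x → subst T eq (ZP.≤⇒≤ᵇ y≤x))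

<⇒<ᶻ : ∀ {x y : ℤ} → x ℤ.< y → (x <ᶻ y) ≡ true
<⇒<ᶻ {x} {y} x<y with y ℤ.≤ᵇ x in eq
... | false = refl
... | true = ⊥-elim (ZP.<⇒≱ x<y (ZP.≤ᵇ⇒≤ (≡true⇒T eq)))

≮ᶻ⇒≥ : ∀ {x y : ℤ} → (x <ᶻ y) ≡ false → y ℤ.≤ x
≮ᶻ⇒≥ {x} {y} e with y ℤ.≤ᵇ x in eq
... | true = ZP.≤ᵇ⇒≤ (≡true⇒T eq)

≥⇒≮ᶻ : ∀ {x y : ℤ} → y ℤ.≤ x → (x <ᶻ y) ≡ false
≥⇒≮ᶻ {x} {y} y≤x with y ℤ.≤ᵇ x in eq
... | true = refl
... | false = ⊥-elim (subst T eq (ZP.≤⇒≤ᵇ y≤x))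

<ᶻ-asym : ∀ {x y : ℤ} → (x <ᶻ y) ≡ true → (y <ᶻ x) ≡ true → ⊥
<ᶻ-asym {x} {y} e e′ = ZP.<-asym (<ᶻ⇒< {x} {y} e) (<ᶻ⇒< {y} {x} e′)

≤ᵇ⇒≤ᶻ : ∀ {x y : ℤ} → (x ℤ.≤ᵇ y) ≡ true → x ℤ.≤ y
≤ᵇ⇒≤ᶻ e = ZP.≤ᵇ⇒≤ (≡true⇒T e)

>⇒≰ᵇᶻ : ∀ {x y : ℤ} → y ℤ.< x → (x ℤ.≤ᵇ y) ≡ false
>⇒≰ᵇᶻ {x} {y} y<x with x ℤ.≤ᵇ y in eq
... | false = refl
... | true = ⊥-elim (ZP.<⇒≱ y<x (≤ᵇ⇒≤ᶻ eq))

<ᵇ⇒< : ∀ {i j : ℕ} → (i ℕ.<ᵇ j) ≡ true → i < j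
<ᵇ⇒< {i} {j} e = NP.<ᵇ⇒< i j (≡true⇒T e)

<⇒<ᵇ : ∀ {i j : ℕ} → i < j → (i ℕ.<ᵇ j) ≡ true
<⇒<ᵇ i<j = T⇒≡true (NP.<⇒<ᵇ i<j)

≮ᵇ⇒≥ : ∀ {i j : ℕ} → (i ℕ.<ᵇ j) ≡ false → j ≤ i
≮ᵇ⇒≥ e = NP.≮⇒≥ (λ i<j → subst T e (NP.<⇒<ᵇ i<j))

≥⇒≮ᵇ : ∀ {i j : ℕ} → j ≤ i → (i ℕ.<ᵇ j) ≡ false
≥⇒≮ᵇ {i} {j} j≤i with i ℕ.<ᵇ j in eq
... | false = refl
... | true = ⊥-elim (NP.<⇒≱ (<ᵇ⇒< eq) j≤i)

<ᵇ-irrefl : ∀ i → (i ℕ.<ᵇ i) ≡ false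
<ᵇ-irrefl i = ≥⇒≮ᵇ (NP.≤-refl {i})

>⇒≰ᵇ : ∀ {i j : ℕ} → j < i → (i ℕ.≤ᵇ j) ≡ false
>⇒≰ᵇ {i} {j} j<i with i ℕ.≤ᵇ j in eq
... | false = refl
... | true = ⊥-elim (NP.<⇒≱ j<i (NP.≤ᵇ⇒≤ i j (≡true⇒T eq)))

indicator : Bool → ℕ
indicator true = 1
indicator false = 0

indicator-mono : ∀ {a b : Bool} → (a ≡ true → b ≡ true) → indicator a ≤ indicator b
indicator-mono {false} _ = z≤n
indicator-mono {true} f rewrite f refl = s≤s z≤n

indicator-split : ∀ a b → indicator a ≡ indicator (a ∧ b) + indicator (a ∧ not b)
indicator-split true true = refl
indicator-split true false = refl
indicator-split false b = refl

filterᵇ-cons : ∀ {A : Set} (P : A → Bool) x xs →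
  filterᵇ P (x ∷ xs) ≡ (if P x then x ∷ filterᵇ P xs else filterᵇ P xs)
filterᵇ-cons P x xs with P x
... | true = refl
... | false = refl

filterᵇ-cong : ∀ {A : Set} {P Q : A → Bool} → (∀ i → P i ≡ Q i) → ∀ xs → filterᵇ P xs ≡ filterᵇ Q xs
filterᵇ-cong {P = P} {Q} e = LP.filter-≐ (T? ∘ P) (T? ∘ Q) ((λ {x} → subst T (e x)) , (λ {x} → subst T (sym (e x))))

filterᵇ-none : ∀ {A : Set} (P : A → Bool) xs → (∀ z → P z ≡ false) → filterᵇ P xs ≡ []
filterᵇ-none P xs never = LP.filter-none (T? ∘ P) (All.universal (λ z → subst T (never z)) xs)

findᵇ-cong : ∀ {A : Set} {P Q : A → Bool} → (∀ i → P i ≡ Q i) → ∀ xs → findᵇ P xs ≡ findᵇ Q xs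
findᵇ-cong e [] = refl
findᵇ-cong {P = P} {Q} e (x ∷ xs) with P x | Q x | e x
... | true | .true | refl = refl
... | false | .false | refl = findᵇ-cong e xs

findᵇ-sound : ∀ {A : Set} (P : A → Bool) xs {l} → findᵇ P xs ≡ just l → P l ≡ true
findᵇ-sound P (x ∷ xs) e with P x in eq
... | true with refl ← e = eq
... | false = findᵇ-sound P xs e

cntL : ∀ {A : Set} → (A → Bool) → List A → ℕ
cntL P xs = length (filterᵇ P xs)

cntL-cons : ∀ {A : Set} (P : A → Bool) x xs → cntL P (x ∷ xs) ≡ indicator (P x) + cntL P xs
cntL-cons P x xs with P x
... | true = refl
... | false = refl

cntL-≤-cons : ∀ {A : Set} (P : A → Bool) x xs → cntL P xs ≤ cntL P (x ∷ xs)
cntL-≤-cons P x xs rewrite cntL-cons P x xs = NP.m≤n+m (cntL P xs) (indicator (P x))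

cntL-map : ∀ {A B : Set} (P : B → Bool) (f : A → B) xs → cntL P (map f xs) ≡ cntL (P ∘ f) xs
cntL-map P f [] = refl
cntL-map P f (x ∷ xs) rewrite cntL-cons P (f x) (map f xs) | cntL-cons (P ∘ f) x xs =
  cong (_+_ (indicator (P (f x)))) (cntL-map P f xs)

cntL-++ : ∀ {A : Set} (P : A → Bool) xs ys → cntL P (xs ++ ys) ≡ cntL P xs + cntL P ys
cntL-++ P xs ys = trans (cong length (LP.filter-++ (T? ∘ P) xs ys)) (LP.length-++ (filterᵇ P xs))

cntL-≤-length : ∀ {A : Set} (P : A → Bool) xs → cntL P xs ≤ length xs
cntL-≤-length P xs = LP.length-filter (T? ∘ P) xs

cntL-filterᵇ : ∀ {A : Set} (P R : A → Bool) xs → cntL P (filterᵇ R xs) ≡ cntL (λ z → R z ∧ P z) xs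
cntL-filterᵇ P R [] = refl
cntL-filterᵇ P R (x ∷ xs) rewrite filterᵇ-cons R x xs | cntL-cons (λ z → R z ∧ P z) x xs with R x
... | true = trans (cntL-cons P x (filterᵇ R xs)) (cong (_+_ (indicator (P x))) (cntL-filterᵇ P R xs))
... | false = cntL-filterᵇ P R xs

cntL-all : ∀ {A : Set} (P : A → Bool) xs → All (λ z → P z ≡ true) xs → cntL P xs ≡ length xs
cntL-all P xs all = cong length (LP.filter-all (T? ∘ P) (All.map ≡true⇒T all))

cntL-none : ∀ {A : Set} (P : A → Bool) xs → All (λ z → P z ≡ false) xs → cntL P xs ≡ 0
cntL-none P xs none = cong length (LP.filter-none (T? ∘ P) (All.map (subst T) none))

cntL-congᴬ : ∀ {A : Set} (P Q : A → Bool) xs → All (λ z → P z ≡ Q z) xs → cntL P xs ≡ cntL Q xs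
cntL-congᴬ P Q [] [] = refl
cntL-congᴬ P Q (x ∷ xs) (e ∷ es) rewrite cntL-cons P x xs | cntL-cons Q x xs | e =
  cong (_+_ (indicator (Q x))) (cntL-congᴬ P Q xs es)

cntL-cons-≡ : ∀ {A : Set} (P : A → Bool) {x} xs {b} → P x ≡ b → cntL P (x ∷ xs) ≡ indicator b + cntL P xs
cntL-cons-≡ P {x} xs Px≡b = trans (cntL-cons P x xs) (cong (λ b → indicator b + cntL P xs) Px≡b)

allFin-suc : ∀ n → allFin (suc n) ≡ Fin.zero ∷ map Fin.suc (allFin n)
allFin-suc n = cong (Fin.zero ∷_) (sym (LP.map-tabulate id Fin.suc))

cnt-suc : ∀ {n} (P : Fin (suc n) → Bool) → cnt P ≡ indicator (P Fin.zero) + cnt (P ∘ Fin.suc)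
cnt-suc {n} P = trans (cong (cntL P) (allFin-suc n))
  (trans (cntL-cons P Fin.zero _) (cong (_+_ (indicator (P Fin.zero))) (cntL-map P Fin.suc (allFin n))))

cnt-cong : ∀ {n} {P Q : Fin n → Bool} → (∀ i → P i ≡ Q i) → cnt P ≡ cnt Q
cnt-cong {n} e = cong length (filterᵇ-cong e (allFin n))

cnt-mono : ∀ {n} {P Q : Fin n → Bool} → (∀ i → P i ≡ true → Q i ≡ true) → cnt P ≤ cnt Q
cnt-mono {zero} e = z≤n
cnt-mono {suc n} {P} {Q} e rewrite cnt-suc P | cnt-suc Q =
  NP.+-mono-≤ (indicator-mono (e Fin.zero)) (cnt-mono (e ∘ Fin.suc))

cnt-all : ∀ {n} → cnt {n} (λ _ → true) ≡ n
cnt-all {n} = trans (cntL-all _ (allFin n) (All.universal (λ _ → refl) _)) (LP.length-tabulate id)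

cnt-none : ∀ {n} → cnt {n} (λ _ → false) ≡ 0
cnt-none {n} = cntL-none _ (allFin n) (All.universal (λ _ → refl) _)

cnt-split : ∀ {n} (P Q : Fin n → Bool) → cnt P ≡ cnt (λ i → P i ∧ Q i) + cnt (λ i → P i ∧ not (Q i))
cnt-split {zero} P Q = refl
cnt-split {suc n} P Q = begin
    cnt P
  ≡⟨ cnt-suc P ⟩
    indicator (P 0F) + cnt (P ∘ Fin.suc)
  ≡⟨ cong₂ _+_ (indicator-split (P 0F) (Q 0F)) (cnt-split (P ∘ Fin.suc) (Q ∘ Fin.suc)) ⟩
    (indicator (P∧Q 0F) + indicator (P∧¬Q 0F)) + (cnt (P∧Q ∘ Fin.suc) + cnt (P∧¬Q ∘ Fin.suc))
  ≡⟨ +-interchange (indicator (P∧Q 0F)) _ _ _ ⟩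
    (indicator (P∧Q 0F) + cnt (P∧Q ∘ Fin.suc)) + (indicator (P∧¬Q 0F) + cnt (P∧¬Q ∘ Fin.suc))
  ≡⟨ sym (cong₂ _+_ (cnt-suc P∧Q) (cnt-suc P∧¬Q)) ⟩
    cnt P∧Q + cnt P∧¬Q
  ∎
  where
  open ≡-Reasoning
  0F : Fin (suc n)
  0F = Fin.zero
  P∧Q P∧¬Q : Fin (suc n) → Bool
  P∧Q i = P i ∧ Q i
  P∧¬Q i = P i ∧ not (Q i)

cnt-mono-< : ∀ {n} {P Q : Fin n → Bool} (i₀ : Fin n) → Q i₀ ≡ false → P i₀ ≡ true →
  (∀ i → Q i ≡ true → P i ≡ true) → cnt Q < cnt P
cnt-mono-< {suc n} {P} {Q} Fin.zero q p e rewrite cnt-suc P | cnt-suc Q | p | q =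
  s≤s (cnt-mono (e ∘ Fin.suc))
cnt-mono-< {suc n} {P} {Q} (Fin.suc i₀) q p e rewrite cnt-suc P | cnt-suc Q =
  NP.≤-trans (NP.≤-reflexive (sym (NP.+-suc (indicator (Q Fin.zero)) (cnt (Q ∘ Fin.suc)))))
    (NP.+-mono-≤ (indicator-mono (e Fin.zero)) (cnt-mono-< i₀ q p (e ∘ Fin.suc)))

cnt<n : ∀ {n} {P : Fin n → Bool} (i₀ : Fin n) → P i₀ ≡ false → cnt P < n
cnt<n {n} {P} i₀ p = subst (cnt P <_) (cnt-all {n}) (cnt-mono-< {P = λ _ → true} i₀ p refl (λ _ _ → refl))

cnt≡0 : ∀ {n} {P : Fin n → Bool} → (∀ i → P i ≢ true) → cnt P ≡ 0
cnt≡0 {n} {P} never =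
  NP.n≤0⇒n≡0 (subst (cnt P ≤_) (cnt-none {n}) (cnt-mono (λ i e → ⊥-elim (never i e))))

cnt-≤1 : ∀ {n} (P : Fin n → Bool) (i₀ : Fin n) → (∀ i → P i ≡ true → i ≡ i₀) → cnt P ≤ 1
cnt-≤1 {suc n} P Fin.zero unique = begin
    cnt P                                      ≡⟨ cnt-suc P ⟩
    indicator (P Fin.zero) + cnt (P ∘ Fin.suc) ≡⟨ cong (_+_ (indicator (P Fin.zero))) (cnt≡0 only-zero) ⟩
    indicator (P Fin.zero) + 0                 ≤⟨ NP.+-monoˡ-≤ 0 (indicator-mono {b = true} (λ _ → refl)) ⟩
    1                                          ∎
  where
  open NP.≤-Reasoning
  only-zero : ∀ i → P (Fin.suc i) ≢ true
  only-zero i e with () ← unique (Fin.suc i) e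
cnt-≤1 {suc n} P (Fin.suc i₀) unique = begin
    cnt P                                      ≡⟨ cnt-suc P ⟩
    indicator (P Fin.zero) + cnt (P ∘ Fin.suc) ≡⟨ cong (λ b → indicator b + cnt (P ∘ Fin.suc)) P₀≡false ⟩
    cnt (P ∘ Fin.suc)                          ≤⟨ cnt-≤1 (P ∘ Fin.suc) i₀ (λ i e → FP.suc-injective (unique (Fin.suc i) e)) ⟩
    1                                          ∎
  where
  open NP.≤-Reasoning
  P₀≡false : P Fin.zero ≡ false
  P₀≡false = BP.¬-not (λ e → FP.0≢1+n (unique Fin.zero e))

minimal-witness : ∀ {n} (P : Fin n → Bool) → 0 < cnt P →
  Σ (Fin n) λ p → P p ≡ true × (∀ i → toℕ i < toℕ p → P i ≡ false)
minimal-witness {suc n} P pos = search (P Fin.zero) refl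
  where
  search : ∀ b → P Fin.zero ≡ b → Σ (Fin (suc n)) λ p → P p ≡ true × (∀ i → toℕ i < toℕ p → P i ≡ false)
  search true P₀ = Fin.zero , P₀ , λ i ()
  search false P₀
    with p , Pp , below ← minimal-witness (P ∘ Fin.suc)
                             (subst (0 <_) (trans (cnt-suc P) (cong (λ b → indicator b + cnt (P ∘ Fin.suc)) P₀)) pos)
    = Fin.suc p , Pp , earlier
    where
    earlier : ∀ i → toℕ i < suc (toℕ p) → P i ≡ false
    earlier Fin.zero _ = P₀
    earlier (Fin.suc i) (s≤s i<p) = below i i<p

Increasing : ∀ {n} → List (Fin n) → Set
Increasing = AllPairs Fin._<_

allFin-increasing : ∀ n → Increasing (allFin n)
allFin-increasing n = AllPairsₚ.tabulate⁺-< id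

filterᵇ-increasing : ∀ {n} (P : Fin n → Bool) {is} → Increasing is → Increasing (filterᵇ P is)
filterᵇ-increasing P = AllPairsₚ.filter⁺ (T? ∘ P)

increasing-prefix : ∀ {n} (pre suf : List (Fin n)) {j} → Increasing (pre ++ suf) → j ∈ suf →
  All (λ i → toℕ i < toℕ j) pre
increasing-prefix [] suf inc j∈suf = []
increasing-prefix (i ∷ pre) suf (i<rest ∷ inc) j∈suf =
  All.lookup i<rest (MP.∈-++⁺ʳ pre j∈suf) ∷ increasing-prefix pre suf inc j∈suf

last-index : ∀ {A : Set} (xs : List A) {x} → x ∈ xs → Σ (Fin (length xs)) λ k → suc (toℕ k) ≡ length xs
last-index (_ ∷ xs) _ = Fin.fromℕ (length xs) , cong suc (FP.toℕ-fromℕ (length xs))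

last-maximal : ∀ {n} (is : List (Fin n)) → Increasing is → ∀ {l} → l ∈ is →
  ∀ k → suc (toℕ k) ≡ length is → toℕ l ≤ toℕ (lookup is k)
last-maximal (i ∷ []) _ (here refl) Fin.zero _ = NP.≤-refl
last-maximal (i ∷ _ ∷ _) _ _ Fin.zero ()
last-maximal (i ∷ is) (i<is ∷ _) (here refl) (Fin.suc k) _ = NP.<⇒≤ (All.lookup i<is (MP.∈-lookup k))
last-maximal (i ∷ is) (_ ∷ inc) (there l∈is) (Fin.suc k) e = last-maximal is inc l∈is k (NP.suc-injective e)

cntL-below-lookup : ∀ {r} (y : Fin r → ℤ) → IsPartition y → ∀ (is : List (Fin r)) → Increasing is →
  ∀ k → cntL (λ i → y i <ᶻ y (lookup is k)) is + suc (toℕ k) ≤ length is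
cntL-below-lookup y y-partition (i ∷ is) (_ ∷ _) Fin.zero
  rewrite cntL-cons (λ z → y z <ᶻ y i) i is | ≥⇒≮ᶻ {y i} {y i} ZP.≤-refl =
  subst (_≤ suc (length is)) (NP.+-comm 1 _) (s≤s (cntL-≤-length _ is))
cntL-below-lookup y y-partition (i ∷ is) (i<is ∷ inc) (Fin.suc k)
  rewrite cntL-cons (λ z → y z <ᶻ y (lookup is k)) i is
        | ≥⇒≮ᶻ {y i} {y (lookup is k)} (y-partition i (lookup is k) (NP.<⇒≤ (All.lookup i<is (MP.∈-lookup k)))) =
  subst (_≤ suc (length is)) (sym (NP.+-suc _ (suc (toℕ k)))) (s≤s (cntL-below-lookup y y-partition is inc k))

later : ∀ {n} → Fin n → Fin n → Bool
later j z = toℕ j ℕ.<ᵇ toℕ z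

m∸[m∸n]≤n : ∀ m n → m ∸ (m ∸ n) ≤ n
m∸[m∸n]≤n m n with NP.≤-total n m
... | inj₁ n≤m = NP.≤-reflexive (NP.m∸[m∸n]≡n n≤m)
... | inj₂ m≤n rewrite NP.m≤n⇒m∸n≡0 m≤n = m≤n

data Countdown {n : ℕ} : ℕ → List (Fin n) → Set where
  []  : Countdown 0 []
  _∷_ : ∀ {K i is} → toℕ i ≡ K → Countdown K is → Countdown (suc K) (i ∷ is)

countdown-map-suc : ∀ {n K} {is : List (Fin n)} → Countdown K is →
  Countdown (suc K) (map Fin.suc is ++ [ Fin.zero ])
countdown-map-suc [] = refl ∷ []
countdown-map-suc (i≡K ∷ D) = cong suc i≡K ∷ countdown-map-suc D

countdown-reverse-allFin : ∀ n → Countdown n (reverse (allFin n))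
countdown-reverse-allFin zero = []
countdown-reverse-allFin (suc n) = subst (Countdown (suc n)) (sym unfold) (countdown-map-suc (countdown-reverse-allFin n))
  where
  unfold : reverse (allFin (suc n)) ≡ map Fin.suc (reverse (allFin n)) ++ [ Fin.zero ]
  unfold = begin
    reverse (allFin (suc n))                            ≡⟨ cong reverse (allFin-suc n) ⟩
    reverse (Fin.zero ∷ map Fin.suc (allFin n))         ≡⟨ LP.unfold-reverse Fin.zero (map Fin.suc (allFin n)) ⟩
    reverse (map Fin.suc (allFin n)) ++ [ Fin.zero ]    ≡⟨ cong (_++ [ Fin.zero ]) (LP.reverse-map Fin.suc (allFin n)) ⟨
    map Fin.suc (reverse (allFin n)) ++ [ Fin.zero ]    ∎
    where open ≡-Reasoning

rights : ∀ {A B : Set} → List (A ⊎ B) → List B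
rights [] = []
rights (inj₁ _ ∷ xs) = rights xs
rights (inj₂ y ∷ xs) = y ∷ rights xs

rights-merge : ∀ {A B : Set} (t : A → B → Bool) xs ys → rights (merge t xs ys) ≡ ys
rights-merge t [] ys = rights-map-inj₂ ys
  where
  rights-map-inj₂ : ∀ {A B : Set} (ys : List B) → rights {A} (map inj₂ ys) ≡ ys
  rights-map-inj₂ [] = refl
  rights-map-inj₂ (y ∷ ys) = cong (y ∷_) (rights-map-inj₂ ys)
rights-merge t (x ∷ xs) [] = rights-map-inj₁ (x ∷ xs)
  where
  rights-map-inj₁ : ∀ {A B : Set} (xs : List A) → rights {A} {B} (map inj₁ xs) ≡ []
  rights-map-inj₁ [] = refl
  rights-map-inj₁ (x ∷ xs) = rights-map-inj₁ xs
rights-merge t (x ∷ xs) (y ∷ ys) = by-cases (t x y) (rights-merge t xs (y ∷ ys)) (cong (y ∷_) (rights-merge t (x ∷ xs) ys))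
  where
  by-cases : ∀ {l l′ r} b → rights l ≡ r → rights (inj₂ y ∷ l′) ≡ r → rights (if b then inj₁ x ∷ l else inj₂ y ∷ l′) ≡ r
  by-cases true e _ = e
  by-cases false _ e = e

rights-++ : ∀ {A B : Set} (xs ys : List (A ⊎ B)) → rights (xs ++ ys) ≡ rights xs ++ rights ys
rights-++ [] ys = refl
rights-++ (inj₁ _ ∷ xs) ys = rights-++ xs ys
rights-++ (inj₂ b ∷ xs) ys = cong (b ∷_) (rights-++ xs ys)

length-rights : ∀ {A B : Set} (xs : List (A ⊎ B)) → length (rights xs) ≤ length xs
length-rights [] = z≤n
length-rights (inj₁ _ ∷ xs) = NP.m≤n⇒m≤1+n (length-rights xs)
length-rights (inj₂ _ ∷ xs) = s≤s (length-rights xs)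

rights-filterᵇ : ∀ {A B : Set} (P : A ⊎ B → Bool) xs → rights (filterᵇ P xs) ≡ filterᵇ (P ∘ inj₂) (rights xs)
rights-filterᵇ P [] = refl
rights-filterᵇ P (inj₁ a ∷ xs) rewrite filterᵇ-cons P (inj₁ a) xs with P (inj₁ a)
... | true = rights-filterᵇ P xs
... | false = rights-filterᵇ P xs
rights-filterᵇ P (inj₂ b ∷ xs) rewrite filterᵇ-cons P (inj₂ b) xs | filterᵇ-cons (P ∘ inj₂) b (rights xs) with P (inj₂ b)
... | true = cong (b ∷_) (rights-filterᵇ P xs)
... | false = rights-filterᵇ P xs

any-isEntry⇒∈rights : ∀ {σ p} (j : Fin p) (xs : List (Fin σ ⊎ Fin p)) → any (isEntry j) xs ≡ true → j ∈ rights xs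
any-isEntry⇒∈rights j (inj₁ _ ∷ xs) e = any-isEntry⇒∈rights j xs e
any-isEntry⇒∈rights j (inj₂ j′ ∷ xs) e with j Fin.≟ j′
... | yes refl = here refl
... | no _ = there (any-isEntry⇒∈rights j xs e)

sumᶻ : List ℤ → ℤ
sumᶻ = foldr ℤ._+_ (+ 0)

sumWhere≡sumᶻ : ∀ {n} (P : Fin n → Bool) f → sumWhere P f ≡ sumᶻ (map f (filterᵇ P (allFin n)))
sumWhere≡sumᶻ {n} P f = trans (foldl-+ (+ 0) (filterᵇ P (allFin n))) (ZP.+-identityˡ _)
  where
  foldl-+ : ∀ z is → foldl (λ acc i → acc ℤ.+ f i) z is ≡ z ℤ.+ sumᶻ (map f is)
  foldl-+ z [] = sym (ZP.+-identityʳ z)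
  foldl-+ z (i ∷ is) = trans (foldl-+ (z ℤ.+ f i) is) (ZP.+-assoc z (f i) (sumᶻ (map f is)))

Exceeds : List ℤ → List ℤ → Set
Exceeds [] vs = ⊤
Exceeds (u ∷ us) vs = suc (length us) ≤ cntL (_<ᶻ u) vs × Exceeds us vs

exceeds-head : ∀ {u us v vs} → length us ≡ length vs → Exceeds (u ∷ us) (v ∷ vs) → v ℤ.< u
exceeds-head {u} {us} {v} {vs} |us|≡|vs| (many , _) = by-cases (v <ᶻ u) refl
  where
  by-cases : ∀ b → (v <ᶻ u) ≡ b → v ℤ.< u
  by-cases true v<u = <ᶻ⇒< v<u
  by-cases false v≮u = ⊥-elim (NP.<⇒≱ too-few many)
    where
    too-few : cntL (_<ᶻ u) (v ∷ vs) < suc (length us)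
    too-few rewrite cntL-cons-≡ (_<ᶻ u) vs v≮u | |us|≡|vs| = s≤s (cntL-≤-length _ vs)

exceeds-tail : ∀ us {v vs} → All (ℤ._≤ v) vs → length us ≤ length vs → Exceeds us (v ∷ vs) → Exceeds us vs
exceeds-tail [] _ _ _ = tt
exceeds-tail (u ∷ us) {v} {vs} vs≤v |u∷us|≤|vs| (many , rest) =
  by-cases (v <ᶻ u) refl , exceeds-tail us vs≤v (NP.<⇒≤ |u∷us|≤|vs|) rest
  where
  by-cases : ∀ b → (v <ᶻ u) ≡ b → suc (length us) ≤ cntL (_<ᶻ u) vs
  by-cases true v<u = subst (suc (length us) ≤_) (sym (cntL-all (_<ᶻ u) vs all-below)) |u∷us|≤|vs|
    where
    all-below : All (λ w → (w <ᶻ u) ≡ true) vs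
    all-below = All.map (λ w≤v → <⇒<ᶻ {_} {u} (ZP.≤-<-trans w≤v (<ᶻ⇒< {v} v<u))) vs≤v
  by-cases false v≮u = subst (suc (length us) ≤_) (cntL-cons-≡ (_<ᶻ u) vs v≮u) many

sumᶻ-< : ∀ u us vs → AllPairs ℤ._≥_ vs → length (u ∷ us) ≡ length vs → Exceeds (u ∷ us) vs →
  sumᶻ vs ℤ.< sumᶻ (u ∷ us)
sumᶻ-≤ : ∀ us vs → AllPairs ℤ._≥_ vs → length us ≡ length vs → Exceeds us vs → sumᶻ vs ℤ.≤ sumᶻ us

sumᶻ-< u us (v ∷ vs) (vs≤v ∷ desc) |u∷us|≡|v∷vs| exc =
  ZP.+-mono-<-≤ (exceeds-head {u} |us|≡|vs| exc)
    (sumᶻ-≤ us vs desc |us|≡|vs| (exceeds-tail us vs≤v (NP.≤-reflexive |us|≡|vs|) (proj₂ exc)))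
  where
  |us|≡|vs| : length us ≡ length vs
  |us|≡|vs| = NP.suc-injective |u∷us|≡|v∷vs|

sumᶻ-≤ [] [] _ _ _ = ZP.≤-refl
sumᶻ-≤ (u ∷ us) vs desc |us|≡|vs| exc = ZP.<⇒≤ (sumᶻ-< u us vs desc |us|≡|vs| exc)

exceeds-filterᵇ : ∀ {p} (x : Fin p → ℤ) (Q : Fin p → Bool) (vs : List ℤ) (is : List (Fin p)) → Increasing is →
  (∀ i → Q i ≡ true → suc (cntL (λ z → Q z ∧ later i z) is) ≤ cntL (_<ᶻ x i) vs) →
  Exceeds (map x (filterᵇ Q is)) vs
exceeds-filterᵇ x Q vs [] _ _ = tt
exceeds-filterᵇ x Q vs (i ∷ is) (i<is ∷ inc) enough =
  subst (λ l → Exceeds (map x l) vs) (sym (filterᵇ-cons Q i is)) (by-cases (Q i) refl)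
  where
  rest : Exceeds (map x (filterᵇ Q is)) vs
  rest = exceeds-filterᵇ x Q vs is inc (λ i′ Qi′ → NP.≤-trans (s≤s (cntL-≤-cons _ i is)) (enough i′ Qi′))
  later-than-i : cntL (λ z → Q z ∧ later i z) (i ∷ is) ≡ length (map x (filterᵇ Q is))
  later-than-i = begin
    cntL (λ z → Q z ∧ later i z) (i ∷ is) ≡⟨ cntL-cons-≡ _ is (trans (cong (Q i ∧_) (<ᵇ-irrefl (toℕ i))) (BP.∧-zeroʳ (Q i))) ⟩
    cntL (λ z → Q z ∧ later i z) is       ≡⟨ cntL-congᴬ _ Q is (All.map (λ {z} i<z → trans (cong (Q z ∧_) (<⇒<ᵇ i<z)) (BP.∧-identityʳ (Q z))) i<is) ⟩
    cntL Q is                             ≡⟨ LP.length-map x (filterᵇ Q is) ⟨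
    length (map x (filterᵇ Q is))         ∎
    where open ≡-Reasoning
  by-cases : ∀ b → Q i ≡ b → Exceeds (map x (if b then i ∷ filterᵇ Q is else filterᵇ Q is)) vs
  by-cases true Qi = subst (λ k → suc k ≤ cntL (_<ᶻ x i) vs) later-than-i (enough i Qi) , rest
  by-cases false _ = rest

module ℤ-Solver = Data.Integer.Solver.+-*-Solver

sub≤sub⇒+≤+ : ∀ a b c d → + a ℤ.- + b ℤ.≤ + c ℤ.- + d → a + d ≤ c + b
sub≤sub⇒+≤+ a b c d le = ZP.drop‿+≤+ (subst₂ ℤ._≤_ lhs rhs (ZP.+-monoˡ-≤ (+ b ℤ.+ + d) le))
  where
  open ℤ-Solver using (solve; _:+_; _:-_; _:=_)
  lhs : (+ a ℤ.- + b) ℤ.+ (+ b ℤ.+ + d) ≡ + (a + d)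
  lhs = solve 3 (λ A B D → (A :- B) :+ (B :+ D) := A :+ D) refl (+ a) (+ b) (+ d)
  rhs : (+ c ℤ.- + d) ℤ.+ (+ b ℤ.+ + d) ≡ + (c + b)
  rhs = solve 3 (λ C B D → (C :- D) :+ (B :+ D) := C :+ B) refl (+ c) (+ b) (+ d)

+<+⇒sub<sub : ∀ a b c d → a + d < c + b → + a ℤ.- + b ℤ.< + c ℤ.- + d
+<+⇒sub<sub a b c d lt = subst₂ ℤ._<_ lhs rhs (ZP.+-monoˡ-< (ℤ.- (+ b ℤ.+ + d)) (ℤ.+<+ lt))
  where
  open ℤ-Solver using (solve; _:+_; _:-_; :-_; _:=_)
  lhs : + (a + d) ℤ.+ ℤ.- (+ b ℤ.+ + d) ≡ + a ℤ.- + b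
  lhs = solve 3 (λ A B D → (A :+ D) :+ (:- (B :+ D)) := A :- B) refl (+ a) (+ b) (+ d)
  rhs : + (c + b) ℤ.+ ℤ.- (+ b ℤ.+ + d) ≡ + c ℤ.- + d
  rhs = solve 3 (λ C B D → (C :+ B) :+ (:- (B :+ D)) := C :- D) refl (+ c) (+ b) (+ d)

+≡sub⇒+≡ : ∀ u a b → + u ≡ + a ℤ.- + b → u + b ≡ a
+≡sub⇒+≡ u a b e = ZP.+-injective (trans (cong (ℤ._+ + b) e) (solve 2 (λ A B → (A :- B) :+ B := A) refl (+ a) (+ b)))
  where open ℤ-Solver using (solve; _:+_; _:-_; _:=_)

-- Decisions depend only on their snapshot

decideWith : ∀ {r} → Maybe (Fin r) → (Fin r → Bool) → Bool → Bool
decideWith (just l) caseA caseB = if caseA l then false else caseB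
decideWith nothing caseA caseB = caseB

decide : ∀ {r} → ℤ → ℤ → Maybe (Fin r) → (Fin r → Bool) → Bool → Bool
decide σ q lMin caseA caseB = if σ <ᶻ q then true else decideWith lMin caseA caseB

decide-cong : ∀ {r} {σ q q′ : ℤ} {lm lm′ : Maybe (Fin r)} {cA cA′ : Fin r → Bool} {cB cB′ : Bool} →
  q ≡ q′ → lm ≡ lm′ → (∀ l → cA l ≡ cA′ l) → cB ≡ cB′ → decide σ q lm cA cB ≡ decide σ q′ lm′ cA′ cB′
decide-cong {lm = nothing} refl refl eA refl = refl
decide-cong {lm = just l} refl refl eA refl rewrite eA l = refl

module PutIn {σ p r : ℕ} (α : Fin σ → ℤ) (x : Fin p → ℤ) (y : Fin r → ℤ) where
  open Step α x y

  putIn≡decide : ∀ X Y j → putIn X Y j ≡ decide (+ σ) (q X Y j) (lMin X Y j) (caseA X Y j) (caseB X Y j)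
  putIn≡decide X Y j with lMin X Y j
  ... | just l = refl
  ... | nothing = refl

  module _ {X X′ : Decisions p} {Y Y′ : Decisions r} (X≗X′ : X ≗ X′) (Y≗Y′ : Y ≗ Y′) (j : Fin p) where

    private
      inY≗ : ∀ (P : Fin r → Bool) i → isIn (Y i) ∧ P i ≡ isIn (Y′ i) ∧ P i
      inY≗ P i = cong (λ z → isIn z ∧ P i) (Y≗Y′ i)

      outX≗ : ∀ (P : Fin p → Bool) i → P i ∧ isOut (X i) ≡ P i ∧ isOut (X′ i)
      outX≗ P i = cong (λ z → P i ∧ isOut z) (X≗X′ i)

    q-cong : q X Y j ≡ q X′ Y′ j
    q-cong = cong₂ (λ A B → + σ ℤ.- + A ℤ.+ + B ℤ.+ + 1)
      (cnt-cong (inY≗ (λ i → y i <ᶻ x j))) (cnt-cong (outX≗ (λ i → toℕ j ℕ.<ᵇ toℕ i)))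

    caseB-cong : caseB X Y j ≡ caseB X′ Y′ j
    caseB-cong = cong₂ (λ q′ (rl : ℤ × ℤ) → not ((+ 0 ℤ.≤ᵇ q′) ∧ (proj₁ rl ℤ.≤ᵇ proj₂ rl))) q-cong
      (cong₂ _,_
        (cong₂ (λ s₁ s₃ → s₁ ℤ.+ x j ℤ.+ s₃)
          (cong (foldl _ _) (filterᵇ-cong (outX≗ (λ i → toℕ j ℕ.<ᵇ toℕ i)) (allFin p)))
          (cong (foldl _ _) (filterᵇ-cong (λ i → cong (ℤ._≤ᵇ + toℕ i) q-cong) (allFin σ))))
        (cong (foldl _ _) (filterᵇ-cong (inY≗ (λ i → y i <ᶻ x j)) (allFin r))))

    lMin-cong : lMin X Y j ≡ lMin X′ Y′ j
    lMin-cong = findᵇ-cong (inY≗ (λ i → y i <ᶻ x j)) (allFin r)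

    caseA-cong : ∀ l → caseA X Y j l ≡ caseA X′ Y′ j l
    caseA-cong l = cong (λ N′ → (+ 1 ℤ.≤ᵇ N′) ∧ any (isEntry j) (drop (length (larger X Y j l) ∸ ℤ.∣ N′ ∣) (larger X Y j l)))
      (cong₂ (λ A B → + cnt (λ i → y l <ᶻ α i) ℤ.- + σ ℤ.+ + A ℤ.- + B ℤ.+ + 1)
        (cnt-cong (λ i → cong (λ z → isIn z ∧ (toℕ l ℕ.<ᵇ toℕ i)) (Y≗Y′ i)))
        (cnt-cong (λ i → cong (λ z → isOut z ∧ (x i <ᶻ y l)) (X≗X′ i))))

    putIn-cong : putIn X Y j ≡ putIn X′ Y′ j
    putIn-cong = begin
      putIn X Y j                                                       ≡⟨ putIn≡decide X Y j ⟩
      decide (+ σ) (q X Y j) (lMin X Y j) (caseA X Y j) (caseB X Y j)      ≡⟨ decide-cong q-cong lMin-cong caseA-cong caseB-cong ⟩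
      decide (+ σ) (q X′ Y′ j) (lMin X′ Y′ j) (caseA X′ Y′ j) (caseB X′ Y′ j) ≡⟨ putIn≡decide X′ Y′ j ⟨
      putIn X′ Y′ j                                                     ∎
      where open ≡-Reasoning

decide-false : ∀ {r σ q} {lm : Maybe (Fin r)} {cA cB} →
  decide σ q lm cA cB ≡ false → (σ <ᶻ q) ≡ false × decideWith lm cA cB ≡ false
decide-false {σ = σ} {q} h with σ <ᶻ q
... | false = refl , h

decideWith-false : ∀ {r} {lm : Maybe (Fin r)} {cA cB} → decideWith lm cA cB ≡ false →
  (∀ l → lm ≡ just l → cA l ≡ false) → cB ≡ false
decideWith-false {lm = nothing} h _ = h
decideWith-false {lm = just l} {cA} h caseA-off with cA l | caseA-off l refl
... | false | _ = h

-- The sweep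

restrict : ∀ {n} → (Fin n → Bool) → Decisions n → Decisions n
restrict P D z = if P z then D z else nothing

restrict-cong : ∀ {n} (P : Fin n → Bool) {D D′ : Decisions n} →
  (∀ z → P z ≡ true → D z ≡ D′ z) → restrict P D ≗ restrict P D′
restrict-cong P eq z with P z in Pz
... | true = eq z Pz
... | false = refl

restrict-id : ∀ {n} (P : Fin n → Bool) {D : Decisions n} →
  (∀ z → P z ≡ false → D z ≡ nothing) → D ≗ restrict P D
restrict-id P none z with P z in Pz
... | true = refl
... | false = none z Pz

decisionAtTurn : ∀ {σ p r} → (Fin σ → ℤ) → (Fin p → ℤ) → (Fin r → ℤ) →
  Decisions p → Decisions r → Fin p → Bool
decisionAtTurn α x y X Y j = Step.putIn α x y (restrict (later j) X) (restrict (λ z → y z <ᶻ x j) Y) j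

upd-≡ : ∀ {n} (D : Decisions n) i v → upd D i v i ≡ just v
upd-≡ D i v with i Fin.≟ i
... | yes _ = refl
... | no i≢i = ⊥-elim (i≢i refl)

upd-≢ : ∀ {n} (D : Decisions n) i v z → z ≢ i → upd D i v z ≡ D z
upd-≢ D i v z z≢i with z Fin.≟ i
... | yes z≡i = ⊥-elim (z≢i z≡i)
... | no _ = refl

-- Entries are processed by decreasing index: those of index below K are pending.
record SweepSide {σ p r : ℕ} (α : Fin σ → ℤ) (x : Fin p → ℤ) (y : Fin r → ℤ)
                 (K L : ℕ) (X : Decisions p) (Y : Decisions r) : Set where
  field
    pending : ∀ i → toℕ i < K → X i ≡ nothing
    decided<pending : ∀ i j → K ≤ toℕ i → toℕ j < L → (x i <ᶻ y j) ≡ true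
    decided : ∀ i → K ≤ toℕ i → X i ≡ just (decisionAtTurn α x y X Y i)

module ProcessEntry {σ σ′ p r : ℕ} {α : Fin σ → ℤ} {β : Fin σ′ → ℤ} {x : Fin p → ℤ} {y : Fin r → ℤ}
  {K L : ℕ} {X : Decisions p} {Y : Decisions r} (x₀ : Fin p) (x₀≡K : toℕ x₀ ≡ K)
  (own : SweepSide α x y (suc K) L X Y) (other : SweepSide β y x L (suc K) Y X) where

  private
    module O = SweepSide own
    module T = SweepSide other

  X′ : Decisions p
  X′ = upd X x₀ (Step.putIn α x y X Y x₀)

  private
    x₀<1+K : toℕ x₀ < suc K
    x₀<1+K = NP.≤-reflexive (cong suc x₀≡K)

    ≢x₀ : ∀ {z} → toℕ z ≢ K → z ≢ x₀
    ≢x₀ z≢K refl = z≢K x₀≡K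

    y-decided<x₀ : ∀ z → L ≤ toℕ z → (y z <ᶻ x x₀) ≡ true
    y-decided<x₀ z L≤z = T.decided<pending z x₀ L≤z x₀<1+K

  decided-x₀ : X′ x₀ ≡ just (decisionAtTurn α x y X′ Y x₀)
  decided-x₀ = trans (upd-≡ X x₀ _) (cong just (PutIn.putIn-cong α x y X≗ Y≗ x₀))
    where
    X≗ : X ≗ restrict (later x₀) X′
    X≗ z with later x₀ z in x₀<z
    ... | true = sym (upd-≢ X x₀ _ z (λ { refl → NP.<-irrefl refl (<ᵇ⇒< {toℕ x₀} x₀<z) }))
    ... | false = O.pending z (s≤s (subst (toℕ z ≤_) x₀≡K (≮ᵇ⇒≥ x₀<z)))
    undecided : ∀ z → (y z <ᶻ x x₀) ≡ false → Y z ≡ nothing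
    undecided z y≮x₀ with L ℕ.≤? toℕ z
    ... | yes L≤z with () ← trans (sym y≮x₀) (y-decided<x₀ z L≤z)
    ... | no L≰z = T.pending z (NP.≰⇒> L≰z)
    Y≗ : Y ≗ restrict (λ z → y z <ᶻ x x₀) Y
    Y≗ = restrict-id _ undecided

  decided-other : ∀ i → K ≤ toℕ i → i ≢ x₀ → X′ i ≡ just (decisionAtTurn α x y X′ Y i)
  decided-other i K≤i i≢x₀ = trans (upd-≢ X x₀ _ i i≢x₀) (trans (O.decided i 1+K≤i)
    (cong just (PutIn.putIn-cong α x y (restrict-cong (later i) unchanged) (λ _ → refl) i)))
    where
    1+K≤i : suc K ≤ toℕ i
    1+K≤i = NP.≤∧≢⇒< K≤i (λ K≡i → i≢x₀ (FP.toℕ-injective (trans (sym K≡i) (sym x₀≡K))))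
    unchanged : ∀ z → later i z ≡ true → X z ≡ X′ z
    unchanged z i<z = sym (upd-≢ X x₀ _ z (λ { refl →
      NP.<-irrefl refl (NP.<-≤-trans (<ᵇ⇒< i<z) (subst (_≤ toℕ i) (sym x₀≡K) K≤i)) }))

  settle : (∀ j → toℕ j < L → (x x₀ <ᶻ y j) ≡ true) → SweepSide α x y K L X′ Y
  settle x₀<pending = record
    { pending = λ i i<K → trans (upd-≢ X x₀ _ i (≢x₀ (NP.<⇒≢ i<K))) (O.pending i (NP.m≤n⇒m≤1+n i<K))
    ; decided<pending = decided<pending
    ; decided = λ i K≤i → by-cases i K≤i (i Fin.≟ x₀)
    }
    where
    decided<pending : ∀ i j → K ≤ toℕ i → toℕ j < L → (x i <ᶻ y j) ≡ true
    decided<pending i j K≤i j<L with toℕ i ℕ.≟ K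
    ... | yes i≡K rewrite FP.toℕ-injective (trans i≡K (sym x₀≡K)) = x₀<pending j j<L
    ... | no i≢K = O.decided<pending i j (NP.≤∧≢⇒< K≤i (i≢K ∘ sym)) j<L
    by-cases : ∀ i → K ≤ toℕ i → Dec (i ≡ x₀) → X′ i ≡ just (decisionAtTurn α x y X′ Y i)
    by-cases i _ (yes refl) = decided-x₀
    by-cases i K≤i (no i≢x₀) = decided-other i K≤i i≢x₀

  observe : SweepSide β y x L K Y X′
  observe = record
    { pending = T.pending
    ; decided<pending = λ i j L≤i j<K → T.decided<pending i j L≤i (NP.m≤n⇒m≤1+n j<K)
    ; decided = λ i L≤i → trans (T.decided i L≤i)
        (cong just (PutIn.putIn-cong β y x (λ _ → refl) (restrict-cong _ (unchanged i L≤i)) i))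
    }
    where
    unchanged : ∀ i → L ≤ toℕ i → ∀ z → (x z <ᶻ y i) ≡ true → X z ≡ X′ z
    unchanged i L≤i z z<i = sym (upd-≢ X x₀ _ z (λ { refl → <ᶻ-asym {x z} z<i (y-decided<x₀ i L≤i) }))

fully-decided : ∀ {σ p r L} {α : Fin σ → ℤ} {x : Fin p → ℤ} {y : Fin r → ℤ} {X : Decisions p} {Y : Decisions r} →
  SweepSide α x y 0 L X Y → X ≗ just ∘ isIn ∘ X
fully-decided side z = just-isIn (SweepSide.decided side z z≤n)
  where
  just-isIn : ∀ {o : Maybe Bool} {v} → o ≡ just v → o ≡ just (isIn o)
  just-isIn {v = true} refl = refl
  just-isIn {v = false} refl = refl

decided-at-turn : ∀ {σ σ′ p r} {α : Fin σ → ℤ} {β : Fin σ′ → ℤ} {x : Fin p → ℤ} {y : Fin r → ℤ}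
  {X : Decisions p} {Y : Decisions r} → SweepSide α x y 0 0 X Y → SweepSide β y x 0 0 Y X →
  ∀ j → isIn (X j) ≡ decisionAtTurn α x y (just ∘ isIn ∘ X) (just ∘ isIn ∘ Y) j
decided-at-turn {α = α} {x = x} {y = y} own other j = trans (isIn-just (SweepSide.decided own j z≤n))
  (PutIn.putIn-cong α x y (restrict-cong _ (λ z _ → fully-decided own z))
                          (restrict-cong _ (λ z _ → fully-decided other z)) j)
  where
  isIn-just : ∀ {o : Maybe Bool} {v} → o ≡ just v → isIn o ≡ v
  isIn-just {v = true} refl = refl
  isIn-just {v = false} refl = refl

module Sweep {s m k n : ℕ} (a : Fin s → ℤ) (d : Fin m → ℤ) (b : Fin k → ℤ) (c : Fin n → ℤ)
  (c-partition : IsPartition c) (d-partition : IsPartition d) (c≢d : ∀ i j → c i ≢ d j) where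
  open Construction a d b c

  Invariant : ℕ → ℕ → State → Set
  Invariant K₁ K₂ (S , Δ) = SweepSide b c d K₁ K₂ S Δ × SweepSide a d c K₂ K₁ Δ S

  step-c : ∀ {K₁ K₂ st} i → toℕ i ≡ K₁ → (∀ j → toℕ j < K₂ → (c i <ᶻ d j) ≡ true) →
    Invariant (suc K₁) K₂ st → Invariant K₁ K₂ (step st (inj₁ i))
  step-c i i≡K₁ i<pending (inv-c , inv-d) = settle i<pending , observe
    where open ProcessEntry i i≡K₁ inv-c inv-d

  step-d : ∀ {K₁ K₂ st} j → toℕ j ≡ K₂ → (∀ i → toℕ i < K₁ → (d j <ᶻ c i) ≡ true) →
    Invariant K₁ (suc K₂) st → Invariant K₁ K₂ (step st (inj₂ j))
  step-d j j≡K₂ j<pending (inv-c , inv-d) = observe , settle j<pending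
    where open ProcessEntry j j≡K₂ inv-d inv-c

  sweep-c : ∀ {K₁ is st} → Countdown K₁ is → Invariant K₁ 0 st → Invariant 0 0 (foldl step st (map inj₁ is))
  sweep-c [] inv = inv
  sweep-c (i≡K ∷ D) inv = sweep-c D (step-c _ i≡K (λ _ ()) inv)

  sweep-d : ∀ {K₂ js st} → Countdown K₂ js → Invariant 0 K₂ st → Invariant 0 0 (foldl step st (map inj₂ js))
  sweep-d [] inv = inv
  sweep-d (j≡K ∷ D) inv = sweep-d D (step-d _ j≡K (λ _ ()) inv)

  sweep : ∀ {K₁ K₂ is js st} → Countdown K₁ is → Countdown K₂ js → Invariant K₁ K₂ st →
    Invariant 0 0 (foldl step st (merge (λ i j → c i <ᶻ d j) is js))
  sweep [] Dj inv = sweep-d Dj inv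
  sweep Di@(_ ∷ _) [] inv = sweep-c Di inv
  sweep {suc K₁} {suc K₂} Di@(_∷_ {i = i} i≡K₁ Di′) Dj@(_∷_ {i = j} j≡K₂ Dj′) inv with c i <ᶻ d j in ci<dj
  ... | true = sweep Di′ Dj (step-c i i≡K₁ i<pending inv)
    where
    i<pending : ∀ j′ → toℕ j′ < suc K₂ → (c i <ᶻ d j′) ≡ true
    i<pending j′ (s≤s j′≤K₂) =
      <⇒<ᶻ (ZP.<-≤-trans (<ᶻ⇒< ci<dj) (d-partition j′ j (subst (toℕ j′ ≤_) (sym j≡K₂) j′≤K₂)))
  ... | false = sweep Di Dj′ (step-d j j≡K₂ j<pending inv)
    where
    dj<ci : d j ℤ.< c i
    dj<ci = ZP.≤∧≢⇒< (≮ᶻ⇒≥ ci<dj) (λ dj≡ci → c≢d i j (sym dj≡ci))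
    j<pending : ∀ i′ → toℕ i′ < suc K₁ → (d j <ᶻ c i′) ≡ true
    j<pending i′ (s≤s i′≤K₁) =
      <⇒<ᶻ (ZP.<-≤-trans dj<ci (c-partition i′ i (subst (toℕ i′ ≤_) (sym i≡K₁) i′≤K₁)))

  initial : Invariant n m ((λ _ → nothing) , (λ _ → nothing))
  initial = side , side
    where
    side : ∀ {σ p r} {α : Fin σ → ℤ} {x : Fin p → ℤ} {y : Fin r → ℤ} {Y} → SweepSide α x y p r (λ _ → nothing) Y
    side = record
      { pending = λ _ _ → refl
      ; decided<pending = λ i _ p≤i _ → ⊥-elim (NP.<⇒≱ (FP.toℕ<n i) p≤i)
      ; decided = λ i p≤i → ⊥-elim (NP.<⇒≱ (FP.toℕ<n i) p≤i)
      }

  final-invariant : Invariant 0 0 final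
  final-invariant = sweep (countdown-reverse-allFin n) (countdown-reverse-allFin m) initial

  inS-at-turn : ∀ i → inS i ≡ decisionAtTurn b c d (just ∘ inS) (just ∘ inΔ) i
  inS-at-turn = decided-at-turn (proj₁ final-invariant) (proj₂ final-invariant)

  inΔ-at-turn : ∀ j → inΔ j ≡ decisionAtTurn a d c (just ∘ inΔ) (just ∘ inS) j
  inΔ-at-turn = decided-at-turn (proj₂ final-invariant) (proj₁ final-invariant)

-- Consequences of the decision rule

module DecisionRule {σ₀ p r : ℕ} (α : Fin (suc σ₀) → ℤ) (x : Fin p → ℤ) (y : Fin r → ℤ)
  (x-partition : IsPartition x) (y-partition : IsPartition y) (y≢x : ∀ i j → y i ≢ x j)
  (inX : Fin p → Bool) (inY : Fin r → Bool)
  (at-turn : ∀ j → inX j ≡ decisionAtTurn α x y (just ∘ inX) (just ∘ inY) j) where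

  σ : ℕ
  σ = suc σ₀

  X : Fin p → Decisions p
  X j = restrict (later j) (just ∘ inX)

  Y : Fin p → Decisions r
  Y j = restrict (λ z → y z <ᶻ x j) (just ∘ inY)

  q : Fin p → ℤ
  q j = Step.q α x y (X j) (Y j) j

  lMin : Fin p → Maybe (Fin r)
  lMin j = Step.lMin α x y (X j) (Y j) j

  caseA : Fin p → Fin r → Bool
  caseA j = Step.caseA α x y (X j) (Y j) j

  caseB : Fin p → Bool
  caseB j = Step.caseB α x y (X j) (Y j) j

  inY-below : Fin p → Fin r → Bool
  inY-below j i = inY i ∧ (y i <ᶻ x j)

  outX-after : Fin p → Fin p → Bool
  outX-after j i = later j i ∧ not (inX i)

  A B : Fin p → ℕ
  A j = cnt (inY-below j)
  B j = cnt (outX-after j)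

  isIn-Y : ∀ j i → isIn (Y j i) ≡ inY-below j i
  isIn-Y j i with y i <ᶻ x j | inY i
  ... | true | true = refl
  ... | true | false = refl
  ... | false | true = refl
  ... | false | false = refl

  isOut-X : ∀ j i → isOut (X j i) ≡ outX-after j i
  isOut-X j i with later j i | inX i
  ... | true | true = refl
  ... | true | false = refl
  ... | false | _ = refl

  inY-snapshot : ∀ j i → isIn (Y j i) ∧ (y i <ᶻ x j) ≡ inY-below j i
  inY-snapshot j i = trans (cong (_∧ (y i <ᶻ x j)) (isIn-Y j i))
    (trans (BP.∧-assoc (inY i) _ _) (cong (inY i ∧_) (BP.∧-idem _)))

  outX-snapshot : ∀ j i → later j i ∧ isOut (X j i) ≡ outX-after j i
  outX-snapshot j i = trans (cong (later j i ∧_) (isOut-X j i))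
    (trans (sym (BP.∧-assoc (later j i) _ _)) (cong (_∧ not (inX i)) (BP.∧-idem _)))

  q-form : ∀ j → q j ≡ + (σ + suc (B j)) ℤ.- + A j
  q-form j = begin
    q j                                       ≡⟨ cong₂ (λ a b → + σ ℤ.- + a ℤ.+ + b ℤ.+ + 1)
                                                   (cnt-cong (inY-snapshot j)) (cnt-cong (outX-snapshot j)) ⟩
    + σ ℤ.- + A j ℤ.+ + B j ℤ.+ + 1           ≡⟨ solve 3 (λ S a b → S :- a :+ b :+ con (+ 1) := (S :+ (con (+ 1) :+ b)) :- a)
                                                   refl (+ σ) (+ A j) (+ B j) ⟩
    + (σ + suc (B j)) ℤ.- + A j               ∎
    where
    open ≡-Reasoning
    open ℤ-Solver using (solve; _:+_; _:-_; _:=_; con)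

  rejected : ∀ j → inX j ≡ false → (+ σ <ᶻ q j) ≡ false × decideWith (lMin j) (caseA j) (caseB j) ≡ false
  rejected j out = decide-false {σ = + σ} {q j} {lMin j} {caseA j} {caseB j}
    (trans (sym (PutIn.putIn≡decide α x y (X j) (Y j) j)) (trans (sym (at-turn j)) out))

  outside⇒B<A : ∀ j → inX j ≡ false → B j < A j
  outside⇒B<A j out =
    NP.+-cancelˡ-≤ σ _ _ (subst (_≤ σ + A j) (NP.+-identityʳ _) (sub≤sub⇒+≤+ (σ + suc (B j)) (A j) σ 0 q≤σ))
    where
    q≤σ : + (σ + suc (B j)) ℤ.- + A j ℤ.≤ + σ ℤ.- + 0
    q≤σ = subst₂ ℤ._≤_ (q-form j) (sym (ZP.+-identityʳ (+ σ))) (≮ᶻ⇒≥ {+ σ} {q j} (proj₁ (rejected j out)))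

  not≡true⇒≡false : ∀ {b} → not b ≡ true → b ≡ false
  not≡true⇒≡false {false} _ = refl

  x-after : ∀ {j i} → later j i ≡ true → x i ℤ.≤ x j
  x-after {j} {i} j<i = x-partition j i (NP.<⇒≤ (<ᵇ⇒< {toℕ j} j<i))

  outX-values : Fin p → List ℤ
  outX-values j = map x (filterᵇ (outX-after j) (allFin p))

  inY-values : Fin p → List ℤ
  inY-values j = map y (filterᵇ (inY-below j) (allFin r))

  cntL-inY-values : ∀ j u → cntL (_<ᶻ u) (inY-values j) ≡ cnt (λ i → inY-below j i ∧ (y i <ᶻ u))
  cntL-inY-values j u = trans (cntL-map (_<ᶻ u) y (filterᵇ (inY-below j) (allFin r))) (cntL-filterᵇ (λ i → y i <ᶻ u) (inY-below j) (allFin r))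

  tight-exceeds : ∀ j → A j ≡ suc (B j) → Exceeds (x j ∷ outX-values j) (inY-values j)
  tight-exceeds j tight = head , exceeds-filterᵇ x (outX-after j) (inY-values j) (allFin p) (allFin-increasing p) rest
    where
    open NP.≤-Reasoning
    head : suc (length (outX-values j)) ≤ cntL (_<ᶻ x j) (inY-values j)
    head = begin
      suc (length (outX-values j))               ≡⟨ cong suc (LP.length-map x (filterᵇ (outX-after j) (allFin p))) ⟩
      suc (B j)                                  ≡⟨ tight ⟨
      A j                                        ≤⟨ cnt-mono (λ i e → ∧-intro e (proj₂ (∧-elim {inY i} e))) ⟩
      cnt (λ i → inY-below j i ∧ (y i <ᶻ x j))   ≡⟨ cntL-inY-values j (x j) ⟨
      cntL (_<ᶻ x j) (inY-values j)              ∎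
    rest : ∀ i → outX-after j i ≡ true →
      suc (cntL (λ z → outX-after j z ∧ later i z) (allFin p)) ≤ cntL (_<ᶻ x i) (inY-values j)
    rest i i-out = begin
      suc (cnt (λ z → outX-after j z ∧ later i z)) ≤⟨ s≤s (cnt-mono after-i) ⟩
      suc (B i)                                    ≤⟨ outside⇒B<A i (not≡true⇒≡false (proj₂ (∧-elim {later j i} i-out))) ⟩
      A i                                          ≤⟨ cnt-mono below-x-j ⟩
      cnt (λ z → inY-below j z ∧ (y z <ᶻ x i))     ≡⟨ cntL-inY-values j (x i) ⟨
      cntL (_<ᶻ x i) (inY-values j)                ∎
      where
      after-i : ∀ z → (outX-after j z ∧ later i z) ≡ true → outX-after i z ≡ true
      after-i z e with ∧-elim {outX-after j z} e
      ... | j-out , i<z = ∧-intro i<z (proj₂ (∧-elim {later j z} j-out))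
      below-x-j : ∀ z → inY-below i z ≡ true → (inY-below j z ∧ (y z <ᶻ x i)) ≡ true
      below-x-j z e with ∧-elim {inY z} e
      ... | z∈Y , z<i = ∧-intro (∧-intro z∈Y (<⇒<ᶻ (ZP.<-≤-trans (<ᶻ⇒< {y z} z<i) (x-after (proj₁ (∧-elim {later j i} i-out)))))) z<i

  tight-caseB-accepts : ∀ j → A j ≡ suc (B j) → caseB j ≡ true
  tight-caseB-accepts j tight = cong not (trans (cong ((+ 0 ℤ.≤ᵇ q j) ∧_) (>⇒≰ᵇᶻ lhs<rhs)) (BP.∧-zeroʳ (+ 0 ℤ.≤ᵇ q j)))
    where
    q≡σ : q j ≡ + σ
    q≡σ = trans (q-form j) (trans (cong (λ a → + (σ + suc (B j)) ℤ.- + a) tight)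
      (solve 2 (λ S K → (S :+ K) :- K := S) refl (+ σ) (+ suc (B j))))
      where open ℤ-Solver using (solve; _:+_; _:-_; _:=_)
    no-α : sumWhere (λ i → q j ℤ.≤ᵇ + toℕ i) α ≡ + 0
    no-α = trans (sumWhere≡sumᶻ (λ i → q j ℤ.≤ᵇ + toℕ i) α) (cong (sumᶻ ∘ map α) (filterᵇ-none _ (allFin σ) (λ i →
      trans (cong (ℤ._≤ᵇ + toℕ i) q≡σ) (>⇒≰ᵇᶻ (ℤ.+<+ (FP.toℕ<n i))))))
    rhs≡ : Step.rhsB α x y (X j) (Y j) j ≡ sumᶻ (x j ∷ outX-values j)
    rhs≡ = trans (cong₂ (λ s₁ s₂ → s₁ ℤ.+ x j ℤ.+ s₂)
                   (trans (sumWhere≡sumᶻ (λ i → later j i ∧ isOut (X j i)) x) (cong (sumᶻ ∘ map x) (filterᵇ-cong (outX-snapshot j) (allFin p)))) no-α)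
                 (trans (ZP.+-identityʳ _) (ZP.+-comm (sumᶻ (outX-values j)) (x j)))
    lhs≡ : Step.lhsB α x y (X j) (Y j) j ≡ sumᶻ (inY-values j)
    lhs≡ = trans (sumWhere≡sumᶻ (λ i → isIn (Y j i) ∧ (y i <ᶻ x j)) y) (cong (sumᶻ ∘ map y) (filterᵇ-cong (inY-snapshot j) (allFin r)))
    nonincreasing : AllPairs ℤ._≥_ (inY-values j)
    nonincreasing = AllPairsₚ.map⁺ (AllPairs.map (λ {i} {z} i<z → y-partition i z (NP.<⇒≤ i<z))
      (filterᵇ-increasing (inY-below j) (allFin-increasing r)))
    same-length : length (x j ∷ outX-values j) ≡ length (inY-values j)
    same-length = trans (cong suc (LP.length-map x (filterᵇ (outX-after j) (allFin p))))
      (trans (sym tight) (sym (LP.length-map y (filterᵇ (inY-below j) (allFin r)))))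
    lhs<rhs : Step.lhsB α x y (X j) (Y j) j ℤ.< Step.rhsB α x y (X j) (Y j) j
    lhs<rhs = subst₂ ℤ._<_ (sym lhs≡) (sym rhs≡)
      (sumᶻ-< (x j) (outX-values j) (inY-values j) nonincreasing same-length (tight-exceeds j tight))

  module TightCaseA (α-last≤Y : ∀ l → inY l ≡ true → α (Fin.fromℕ σ₀) ℤ.≤ y l)
    (j : Fin p) (tight : A j ≡ suc (B j)) (l : Fin r) (l-below : inY-below j l ≡ true) where

    N : ℤ
    N = Step.N α x y (X j) (Y j) j l

    larger : List (Fin σ ⊎ Fin p)
    larger = Step.larger α x y (X j) (Y j) j l

    α-above Y-after-l out-below out-above : ℕ
    α-above = cnt (λ i → y l <ᶻ α i)
    Y-after-l = cnt (λ i → inY-below j i ∧ later l i)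
    out-below = cnt (λ i → outX-after j i ∧ (x i <ᶻ y l))
    out-above = cnt (λ i → outX-after j i ∧ not (x i <ᶻ y l))

    N≡ : N ≡ + (α-above + Y-after-l + 1) ℤ.- + (σ + out-below)
    N≡ = trans (cong₂ (λ c e → + α-above ℤ.- + σ ℤ.+ + c ℤ.- + e ℤ.+ + 1)
                  (cnt-cong (λ i → cong (_∧ later l i) (isIn-Y j i)))
                  (cnt-cong (λ i → cong (_∧ (x i <ᶻ y l)) (isOut-X j i))))
      (solve 4 (λ a s c e → a :- s :+ c :- e :+ con (+ 1) := (a :+ c :+ con (+ 1)) :- (s :+ e))
        refl (+ α-above) (+ σ) (+ Y-after-l) (+ out-below))
      where open ℤ-Solver using (solve; _:+_; _:-_; _:=_; con)

    α-above<σ : α-above < σ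
    α-above<σ = cnt<n {P = λ i → y l <ᶻ α i} (Fin.fromℕ σ₀) (≥⇒≮ᶻ {y l} (α-last≤Y l (proj₁ (∧-elim {inY l} l-below))))

    Y-after-l<A : Y-after-l < A j
    Y-after-l<A = cnt-mono-< l (trans (cong (inY-below j l ∧_) (<ᵇ-irrefl (toℕ l))) (BP.∧-zeroʳ _)) l-below
      (λ i e → proj₁ (∧-elim {inY-below j i} e))

    ∣N∣≤out-above : + 1 ℤ.≤ N → ℤ.∣ N ∣ ≤ out-above
    ∣N∣≤out-above 1≤N = NP.+-cancelʳ-≤ (suc (σ + out-below)) ℤ.∣ N ∣ out-above (begin
      ℤ.∣ N ∣ + suc (σ + out-below)   ≡⟨ NP.+-suc ℤ.∣ N ∣ _ ⟩
      suc (ℤ.∣ N ∣ + (σ + out-below)) ≡⟨ cong suc (+≡sub⇒+≡ ℤ.∣ N ∣ _ _ (trans ∣N∣≡N N≡)) ⟩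
      suc (α-above + Y-after-l + 1)   ≡⟨ solve 2 (λ a c → con 1 :+ (a :+ c :+ con 1) := (con 1 :+ a) :+ (con 1 :+ c)) refl α-above Y-after-l ⟩
      suc α-above + suc Y-after-l     ≤⟨ NP.+-mono-≤ α-above<σ (subst (suc Y-after-l ≤_) (trans tight (cong suc B≡)) Y-after-l<A) ⟩
      σ + suc (out-below + out-above) ≡⟨ solve 3 (λ s e c → s :+ (con 1 :+ (e :+ c)) := c :+ (con 1 :+ (s :+ e))) refl σ out-below out-above ⟩
      out-above + suc (σ + out-below) ∎)
      where
      open NP.≤-Reasoning
      open Data.Nat.Solver.+-*-Solver using (solve; _:+_; _:=_; con)
      ∣N∣≡N : + ℤ.∣ N ∣ ≡ N
      ∣N∣≡N = ZP.0≤i⇒+∣i∣≡i (ZP.≤-trans (ℤ.+≤+ z≤n) 1≤N)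
      B≡ : B j ≡ out-below + out-above
      B≡ = cnt-split (outX-after j) (λ i → x i <ᶻ y l)

    x-above-from-j : Fin p → Bool
    x-above-from-j i = (y l <ᶻ x i) ∧ (toℕ j ℕ.≤ᵇ toℕ i)

    out-above<x-above-from-j : out-above < cnt x-above-from-j
    out-above<x-above-from-j = cnt-mono-< j
      (cong (λ b → (b ∧ not (inX j)) ∧ not (x j <ᶻ y l)) (<ᵇ-irrefl (toℕ j)))
      (∧-intro (proj₂ (∧-elim {inY l} l-below)) (T⇒≡true (NP.≤⇒≤ᵇ (NP.≤-refl {toℕ j}))))
      above
      where
      above : ∀ i → (outX-after j i ∧ not (x i <ᶻ y l)) ≡ true → x-above-from-j i ≡ true
      above i e with ∧-elim {outX-after j i} e
      ... | i-out , x≮y with x i <ᶻ y l in x<y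
      ... | false = ∧-intro (<⇒<ᶻ (ZP.≤∧≢⇒< (≮ᶻ⇒≥ x<y) (y≢x l i)))
                      (T⇒≡true (NP.≤⇒≤ᵇ (NP.<⇒≤ (<ᵇ⇒< {toℕ j} (proj₁ (∧-elim {later j i} i-out))))))

    -- Restricted to x, the entries of e above y_l are the x_i > y_l in increasing index order.
    x-above-from-j≤∣N∣ : any (isEntry j) (drop (length larger ∸ ℤ.∣ N ∣) larger) ≡ true →
      cnt x-above-from-j ≤ ℤ.∣ N ∣
    x-above-from-j≤∣N∣ j-among = begin
      cnt x-above-from-j                        ≡⟨ cntL-filterᵇ from-j x-above (allFin p) ⟨
      cntL from-j (filterᵇ x-above (allFin p))  ≡⟨ cong (cntL from-j) (trans (sym rights-larger) rights-split) ⟩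
      cntL from-j (pre ++ suf)                  ≡⟨ cntL-++ from-j pre suf ⟩
      cntL from-j pre + cntL from-j suf         ≡⟨ cong (_+ cntL from-j suf) (cntL-none from-j pre (All.map >⇒≰ᵇ pre<j)) ⟩
      cntL from-j suf                           ≤⟨ cntL-≤-length from-j suf ⟩
      length suf                                ≤⟨ length-rights (drop K larger) ⟩
      length (drop K larger)                    ≡⟨ LP.length-drop K larger ⟩
      length larger ∸ K                         ≤⟨ m∸[m∸n]≤n (length larger) ℤ.∣ N ∣ ⟩
      ℤ.∣ N ∣                                   ∎
      where
      open NP.≤-Reasoning
      K : ℕ
      K = length larger ∸ ℤ.∣ N ∣
      pre suf : List (Fin p)
      pre = rights (take K larger)
      suf = rights (drop K larger)
      x-above : Fin p → Bool
      x-above i = y l <ᶻ x i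
      from-j : Fin p → Bool
      from-j i = toℕ j ℕ.≤ᵇ toℕ i
      rights-larger : rights larger ≡ filterᵇ x-above (allFin p)
      rights-larger = trans (rights-filterᵇ _ (Step.eList α x y (X j) (Y j)))
        (cong (filterᵇ x-above) (rights-merge _ (allFin σ) (allFin p)))
      rights-split : rights larger ≡ pre ++ suf
      rights-split = trans (cong rights (sym (LP.take++drop≡id K larger))) (rights-++ (take K larger) (drop K larger))
      pre<j : All (λ i → toℕ i < toℕ j) pre
      pre<j = increasing-prefix pre suf
        (subst Increasing (trans (sym rights-larger) rights-split) (filterᵇ-increasing x-above (allFin-increasing p)))
        (any-isEntry⇒∈rights j (drop K larger) j-among)

    rejects : caseA j l ≡ false
    rejects with caseA j l in accepted
    ... | false = refl
    ... | true with ∧-elim {+ 1 ℤ.≤ᵇ N} accepted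
    ... | 1≤N , j-among = ⊥-elim (NP.<⇒≱ (NP.<-≤-trans out-above<x-above-from-j (x-above-from-j≤∣N∣ j-among))
                                        (∣N∣≤out-above (≤ᵇ⇒≤ᶻ 1≤N)))

  tight-caseA-off : (∀ l → inY l ≡ true → α (Fin.fromℕ σ₀) ℤ.≤ y l) → ∀ j → A j ≡ suc (B j) →
    ∀ l → lMin j ≡ just l → caseA j l ≡ false
  tight-caseA-off α-last≤Y j tight l found = TightCaseA.rejects α-last≤Y j tight l
    (trans (sym (inY-snapshot j l)) (findᵇ-sound (λ i → isIn (Y j i) ∧ (y i <ᶻ x j)) (allFin r) found))

  outside⇒B+1<A : (∀ l → inY l ≡ true → α (Fin.fromℕ σ₀) ℤ.≤ y l) → ∀ j → inX j ≡ false → suc (B j) < A j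
  outside⇒B+1<A α-last≤Y j out with NP.m≤n⇒m<n∨m≡n (outside⇒B<A j out)
  ... | inj₁ B+1<A = B+1<A
  ... | inj₂ B+1≡A with () ← trans (sym (tight-caseB-accepts j (sym B+1≡A)))
                                (decideWith-false (proj₂ (rejected j out)) (tight-caseA-off α-last≤Y j (sym B+1≡A)))

  outside-count : ∀ (Θ : Fin p → Bool) {p₀} → (not (inX p₀) ∧ Θ p₀) ≡ true →
    (∀ i → toℕ i < toℕ p₀ → (not (inX i) ∧ Θ i) ≡ false) → cnt (λ i → not (inX i) ∧ Θ i) ≤ suc (B p₀)
  outside-count Θ {p₀} _ before = begin
    cnt P                                                               ≡⟨ cnt-split P (later p₀) ⟩
    cnt (λ i → P i ∧ later p₀ i) + cnt (λ i → P i ∧ not (later p₀ i))   ≤⟨ NP.+-mono-≤ (cnt-mono after) (cnt-≤1 _ p₀ unique) ⟩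
    B p₀ + 1                                                            ≡⟨ NP.+-comm (B p₀) 1 ⟩
    suc (B p₀)                                                          ∎
    where
    open NP.≤-Reasoning
    P : Fin p → Bool
    P i = not (inX i) ∧ Θ i
    after : ∀ i → (P i ∧ later p₀ i) ≡ true → outX-after p₀ i ≡ true
    after i e with ∧-elim {P i} e
    ... | Pi , p₀<i = ∧-intro p₀<i (proj₁ (∧-elim {not (inX i)} Pi))
    unique : ∀ i → (P i ∧ not (later p₀ i)) ≡ true → i ≡ p₀
    unique i e with ∧-elim {P i} e
    ... | Pi , i≯p₀ with toℕ i ℕ.<? toℕ p₀
    ... | yes i<p₀ with () ← trans (sym (before i i<p₀)) Pi
    ... | no i≮p₀ = FP.toℕ-injective (NP.≤-antisym (≮ᵇ⇒≥ {toℕ p₀} (not≡true⇒≡false i≯p₀)) (NP.≮⇒≥ i≮p₀))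

  few-outside : (∀ l → inY l ≡ true → α (Fin.fromℕ σ₀) ℤ.≤ y l) →
    ∀ (Θ : Fin p → Bool) M → 0 < M → (∀ i → Θ i ≡ true → A i ≤ M) → cnt (λ i → not (inX i) ∧ Θ i) < M
  few-outside α-last≤Y Θ M 0<M A≤M with NP.m≤n⇒m<n∨m≡n (z≤n {cnt (λ i → not (inX i) ∧ Θ i)})
  ... | inj₂ 0≡cnt = subst (_< M) 0≡cnt 0<M
  ... | inj₁ 0<cnt with p₀ , Pp₀ , before ← minimal-witness (λ i → not (inX i) ∧ Θ i) 0<cnt = begin-strict
    cnt (λ i → not (inX i) ∧ Θ i) ≤⟨ outside-count Θ Pp₀ before ⟩
    suc (B p₀)                    <⟨ outside⇒B+1<A α-last≤Y p₀ (not≡true⇒≡false (proj₁ (∧-elim {not (inX p₀)} Pp₀))) ⟩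
    A p₀                          ≤⟨ A≤M p₀ (proj₂ (∧-elim {not (inX p₀)} Pp₀)) ⟩
    M                             ∎
    where open NP.≤-Reasoning

  Ylist : List (Fin r)
  Ylist = filterᵇ inY (allFin r)

  module _ (α-last≤Y-last : ∀ k → suc (toℕ k) ≡ length Ylist → α (Fin.fromℕ σ₀) ℤ.≤ y (lookup Ylist k)) where

    α-last≤Y : ∀ l → inY l ≡ true → α (Fin.fromℕ σ₀) ℤ.≤ y l
    α-last≤Y l l∈Y = ZP.≤-trans (α-last≤Y-last k k-last)
      (y-partition l (lookup Ylist k) (last-maximal Ylist (filterᵇ-increasing inY (allFin-increasing r)) l∈Ylist k k-last))
      where
      l∈Ylist : l ∈ Ylist
      l∈Ylist = MP.∈-filter⁺ (T? ∘ inY) (MP.∈-allFin l) (≡true⇒T l∈Y)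
      k : Fin (length Ylist)
      k = proj₁ (last-index Ylist l∈Ylist)
      k-last : suc (toℕ k) ≡ length Ylist
      k-last = proj₂ (last-index Ylist l∈Ylist)

    fewer-than-X+Y : 0 < length Ylist → p < length (filterᵇ inX (allFin p)) + length Ylist
    fewer-than-X+Y 0<|Y| = subst (_< cnt inX + length Ylist) (sym p≡) (NP.+-monoʳ-< (cnt inX) outside<|Y|)
      where
      outside<|Y| : cnt (λ i → not (inX i) ∧ true) < length Ylist
      outside<|Y| = few-outside α-last≤Y (λ _ → true) (length Ylist) 0<|Y| (λ i _ → cnt-mono (λ z e → proj₁ (∧-elim {inY z} e)))
      p≡ : p ≡ cnt inX + cnt (λ i → not (inX i) ∧ true)
      p≡ = trans (sym (cnt-all {p})) (trans (cnt-split (λ _ → true) inX)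
             (cong (_+_ (cnt inX)) (cnt-cong (λ i → sym (BP.∧-identityʳ (not (inX i)))))))

    outside-below-Y : ∀ k → suc (toℕ k) < length Ylist →
      cnt (λ i → not (inX i) ∧ (x i <ᶻ y (lookup Ylist k))) + suc (toℕ k) < length Ylist
    outside-below-Y k k+1<|Y| = NP.m≤o∸n⇒m+n≤o _ (NP.<⇒≤ k+1<|Y|)
      (few-outside α-last≤Y _ (length Ylist ∸ suc (toℕ k)) (NP.m<n⇒0<n∸m k+1<|Y|) A≤rank)
      where
      θ : ℤ
      θ = y (lookup Ylist k)
      A≤rank : ∀ i → (x i <ᶻ θ) ≡ true → A i ≤ length Ylist ∸ suc (toℕ k)
      A≤rank i x<θ = begin
        A i                         ≤⟨ cnt-mono below-θ ⟩
        cnt (λ z → inY z ∧ (y z <ᶻ θ)) ≡⟨ cntL-filterᵇ (λ z → y z <ᶻ θ) inY (allFin r) ⟨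
        cntL (λ z → y z <ᶻ θ) Ylist ≤⟨ NP.m+n≤o⇒m≤o∸n _ (cntL-below-lookup y y-partition Ylist (filterᵇ-increasing inY (allFin-increasing r)) k) ⟩
        length Ylist ∸ suc (toℕ k)  ∎
        where
        open NP.≤-Reasoning
        below-θ : ∀ z → inY-below i z ≡ true → (inY z ∧ (y z <ᶻ θ)) ≡ true
        below-θ z e with ∧-elim {inY z} e
        ... | z∈Y , z<i = ∧-intro z∈Y (<⇒<ᶻ {y z} {θ} (ZP.<-trans (<ᶻ⇒< {y z} z<i) (<ᶻ⇒< {x i} x<θ)))

t₀<σ : ∀ p σ u v → p < u + v → + (p + σ) ℤ.- + u ℤ.- + v ℤ.< + σ
t₀<σ p σ u v p<u+v = subst₂ ℤ._<_ rearranged (ZP.+-identityʳ (+ σ)) (+<+⇒sub<sub (p + σ) (u + v) σ 0 shifted)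
  where
  open ℤ-Solver using (solve; _:-_; _:+_; _:=_)
  rearranged : + (p + σ) ℤ.- + (u + v) ≡ + (p + σ) ℤ.- + u ℤ.- + v
  rearranged = solve 3 (λ P U V → P :- (U :+ V) := P :- U :- V) refl (+ (p + σ)) (+ u) (+ v)
  shifted : p + σ + 0 < σ + (u + v)
  shifted = subst₂ _<_ (sym (NP.+-identityʳ (p + σ))) (NP.+-comm (u + v) σ) (NP.+-monoˡ-< σ p<u+v)

tⱼ<σ : ∀ σ hy k C → C + k < hy → + σ ℤ.- (+ hy ℤ.- + k) ℤ.+ + C ℤ.< + σ
tⱼ<σ σ hy k C C+k<hy = subst₂ ℤ._<_ rearranged (ZP.+-identityʳ (+ σ)) (+<+⇒sub<sub (σ + (k + C)) hy σ 0 shifted)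
  where
  open ℤ-Solver using (solve; _:-_; _:+_; _:=_)
  rearranged : + (σ + (k + C)) ℤ.- + hy ≡ + σ ℤ.- (+ hy ℤ.- + k) ℤ.+ + C
  rearranged = solve 4 (λ S Y K C′ → (S :+ (K :+ C′)) :- Y := S :- (Y :- K) :+ C′) refl (+ σ) (+ hy) (+ k) (+ C)
  shifted : σ + (k + C) + 0 < σ + hy
  shifted = subst (_< σ + hy) (trans (cong (_+_ σ) (NP.+-comm C k)) (sym (NP.+-identityʳ _))) (NP.+-monoʳ-< σ C+k<hy)

corollary3p12 : ∀ (m₀ n₀ s₀ k₀ : ℕ) → suc m₀ + suc s₀ ≡ suc n₀ + suc k₀ →
    (a : Fin (suc s₀) → ℤ) (d : Fin (suc m₀) → ℤ)
    (b : Fin (suc k₀) → ℤ) (c : Fin (suc n₀) → ℤ) →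
    IsPartition a → IsPartition d → IsPartition b → IsPartition c →
    (∀ i j → c i ≢ d j) →
    let open Construction a d b c in
    (cLastGe (a (Fin.fromℕ s₀)) →
      ∀ (y : Fin (suc h')) → toℕ y ℕ.< h' → t y ℤ.< + suc s₀)
    × (dLastGe (b (Fin.fromℕ k₀)) →
      ∀ (x : Fin (suc h)) → toℕ x ℕ.< h → t' x ℤ.< + suc k₀)
corollary3p12 m₀ n₀ s₀ k₀ _ a d b c _ d-partition _ c-partition c≢d = Δ-bounds , S-bounds
  where
  open Construction a d b c
  open Sweep a d b c c-partition d-partition c≢d
  module Δ-side = DecisionRule a d c d-partition c-partition c≢d inΔ inS inΔ-at-turn
  module S-side = DecisionRule b c d c-partition d-partition (λ i j e → c≢d j i (sym e)) inS inΔ inS-at-turn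

  Δ-bounds : cLastGe (a (Fin.fromℕ s₀)) → ∀ (y : Fin (suc h')) → toℕ y ℕ.< h' → t y ℤ.< + suc s₀
  Δ-bounds a≤c Fin.zero 0<h' = t₀<σ (suc m₀) (suc s₀) h h' (Δ-side.fewer-than-X+Y a≤c 0<h')
  Δ-bounds a≤c (Fin.suc j) j+1<h' = tⱼ<σ (suc s₀) h' (suc (toℕ j)) _ (Δ-side.outside-below-Y a≤c j j+1<h')

  S-bounds : dLastGe (b (Fin.fromℕ k₀)) → ∀ (x : Fin (suc h)) → toℕ x ℕ.< h → t' x ℤ.< + suc k₀
  S-bounds b≤d Fin.zero 0<h = t₀<σ (suc n₀) (suc k₀) h h' (subst (suc n₀ <_) (NP.+-comm h' h) (S-side.fewer-than-X+Y b≤d 0<h))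
  S-bounds b≤d (Fin.suc j) j+1<h = tⱼ<σ (suc k₀) h (suc (toℕ j)) _ (S-side.outside-below-Y b≤d j j+1<h)
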